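{- Let $n,m,k$ be nonnegative integers with $m\le n$ and $k\ge 1$. (a) If $p$ is a prime greater than $3$, then $$\binom{np^k}{mp^k}\equiv \binom{np^{\lfloor (k-1)/3\rfloor}}{mp^{\lfloor (k-1)/3\rfloor}}\pmod{p^k}.$$ (b) $$\binom{n\cdot 2^k}{m\cdot 2^k}\equiv \binom{n\cdot 2^{\lfloor k/2\rfloor}}{m\cdot 2^{\lfloor k/2\rfloor}}\pmod{2^k}.$$ (c) $$\binom{n\cdot 3^k}{m\cdot 3^k}\equiv \binom{n\cdot 3^{\lfloor (k-1)/2\rfloor}}{m\cdot 3^{\lfloor (k-1)/2\rfloor}}\pmod{3^k}.$$
   Context: $\lfloor a\rfloor$ denotes the greatest integer less than or equal to $a$. -}

module Defs where

open import Data.Nat using (ℕ)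
open import Data.Integer using (+_; _-_)
open import Data.Integer.Divisibility using (_∣_)

_≡_[mod_] : (a b n : ℕ) → Set
a ≡ b [mod n ] = (+ n) ∣ ((+ a) - (+ b))

{-# OPTIONS --safe #-}
module Submission where

-- Fix a prime p, put Q = p^s and P = pQ, and let Φ(t) be the product of u + t over 0 ≤ u < P
-- with p ∤ u. Separating the factors prime to p from the multiples of p gives
-- (nP)! = D(nP) · p^(nQ) (nQ)!  with  D(nP) = Φ(0) Φ(P) ⋯ Φ((n−1)P),
-- hence C(aP,bP) D(bP) D((a−b)P) = D(aP) C(aQ,bQ): the binomials at levels s+1 and s agree
-- modulo every power of p modulo which Φ(iP) ≡ Φ(0) for all i. Writing Φ(t) = e₀ + e₁t + e₂t² mod t³,
-- this always holds modulo P; the symmetry u ↦ P − u gives Φ(0) = Φ(−P) when the number of units is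
-- even, hence the congruence modulo P²; and for p > 3 the permutation u ↦ 2u of the units shows
-- P ∣ e₂, hence modulo P³. Chaining these steps from level ⌊…⌋ up to k gives the three statements.

open import Defs
open import Level using (0ℓ)
open import Algebra.Bundles using (CommutativeMonoid)
open import Algebra.Structures using (IsCommutativeMonoid)
import Algebra.Properties.CommutativeMonoid.Sum as MonoidSum
import Algebra.Properties.CommutativeSemigroup as CommutativeSemigroupProperties
open import Data.Nat as ℕ using (ℕ; zero; suc; _<_; _≤_; _>_; _∸_; _/_; _%_; _!; z≤n; s≤s; NonZero)
open import Data.Nat.Properties using (_!≢0; _!*_!≢0)
import Data.Nat.Properties as ℕP
import Data.Nat.Divisibility as ℕD
open import Data.Nat.Combinatorics using (_C_; nCk≡n!/k![n-k]!; k![n∸k]!∣n!)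
import Data.Nat.DivMod as ℕDM
open ℕDM using (m/n*n≡m)
open import Data.Nat.Primality using (Prime; composite; euclidsLemma; prime?; prime[2]; prime⇒nonZero; prime⇒nonTrivial)
open import Data.Fin using (Fin; toℕ; fromℕ<)
import Data.Fin.Properties as FinP
open import Data.Fin.Permutation using (Permutation; permutation)
open import Data.Integer.Base using (ℤ; +_; _+_; _*_; -_; _-_; _^_; 0ℤ; 1ℤ; -1ℤ; ∣_∣)
import Data.Integer.Properties as ℤP
open import Data.Integer.Divisibility.Signed
  using (_∣_; divides; ∣ᵤ⇒∣; ∣⇒∣ᵤ; ∣-refl; ∣-trans; ∣m⇒∣-m; ∣m∣n⇒∣m+n; ∣n⇒∣m*n; ∣m⇒∣m*n)
open import Data.Integer.Tactic.RingSolver using (solve-∀)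
import Data.Nat.Tactic.RingSolver as ℕSolver
open import Data.Product using (∃; _,_; _×_; proj₁; proj₂)
open import Data.Sum using (inj₁; inj₂)
open import Data.Empty using (⊥-elim)
open import Function using (_∘_)
open import Relation.Nullary using (¬_; does; yes; no)
open import Relation.Nullary.Decidable using (dec-true; dec-false; does-⇔; toWitness)
open import Data.Unit using (tt)
open import Data.Bool using (true; false; if_then_else_)
open import Function.Bundles using (mk⇔)
open import Relation.Binary.Bundles using (Setoid)
import Relation.Binary.Reasoning.Setoid as SetoidReasoning
open import Relation.Binary.PropositionalEquality
  using (_≡_; refl; sym; trans; cong; cong₂; subst; subst₂; isEquivalence; module ≡-Reasoning)

infix 4 _≡_[modℤ_]
record _≡_[modℤ_] (x y q : ℤ) : Set where
  constructor modℤ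
  field ∣-difference : q ∣ x - y
open _≡_[modℤ_]

module _ {q : ℤ} where

  modℤ-refl : ∀ {x} → x ≡ x [modℤ q ]
  modℤ-refl {x} = modℤ (divides 0ℤ (x-x≡0*q x q))
    where
    x-x≡0*q : ∀ x q → x - x ≡ 0ℤ * q
    x-x≡0*q = solve-∀

  modℤ-reflexive : ∀ {x y} → x ≡ y → x ≡ y [modℤ q ]
  modℤ-reflexive refl = modℤ-refl

  modℤ-sym : ∀ {x y} → x ≡ y [modℤ q ] → y ≡ x [modℤ q ]
  modℤ-sym {x} {y} (modℤ d) = modℤ (subst (q ∣_) (y-x≡-[x-y] x y) (∣m⇒∣-m d))
    where
    y-x≡-[x-y] : ∀ x y → - (x - y) ≡ y - x
    y-x≡-[x-y] = solve-∀

  modℤ-trans : ∀ {x y z} → x ≡ y [modℤ q ] → y ≡ z [modℤ q ] → x ≡ z [modℤ q ]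
  modℤ-trans {x} {y} {z} (modℤ d) (modℤ e) = modℤ (subst (q ∣_) (telescope x y z) (∣m∣n⇒∣m+n d e))
    where
    telescope : ∀ x y z → (x - y) + (y - z) ≡ x - z
    telescope = solve-∀

  modℤ-+ : ∀ {x y u v} → x ≡ y [modℤ q ] → u ≡ v [modℤ q ] → x + u ≡ y + v [modℤ q ]
  modℤ-+ {x} {y} {u} {v} (modℤ d) (modℤ e) = modℤ (subst (q ∣_) (regroup x y u v) (∣m∣n⇒∣m+n d e))
    where
    regroup : ∀ x y u v → (x - y) + (u - v) ≡ (x + u) - (y + v)
    regroup = solve-∀

  modℤ-*ˡ : ∀ c {x y} → x ≡ y [modℤ q ] → c * x ≡ c * y [modℤ q ]
  modℤ-*ˡ c {x} {y} (modℤ d) = modℤ (subst (q ∣_) (distrib c x y) (∣n⇒∣m*n c d))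
    where
    distrib : ∀ c x y → c * (x - y) ≡ c * x - c * y
    distrib = solve-∀

  modℤ-*ʳ : ∀ c {x y} → x ≡ y [modℤ q ] → x * c ≡ y * c [modℤ q ]
  modℤ-*ʳ c {x} {y} x≡y = subst₂ (λ a b → a ≡ b [modℤ q ]) (ℤP.*-comm c x) (ℤP.*-comm c y) (modℤ-*ˡ c x≡y)

  modℤ-* : ∀ {x y u v} → x ≡ y [modℤ q ] → u ≡ v [modℤ q ] → x * u ≡ y * v [modℤ q ]
  modℤ-* {y = y} {u} x≡y u≡v = modℤ-trans (modℤ-*ʳ u x≡y) (modℤ-*ˡ y u≡v)

*-monoˡ-∣ : ∀ {d e} c → d ∣ e → d * c ∣ e * c
*-monoˡ-∣ {d} c (divides k e≡kd) = divides k (trans (cong (_* c) e≡kd) (ℤP.*-assoc k d c))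

modℤ-setoid : ℤ → Setoid 0ℓ 0ℓ
modℤ-setoid q = record
  { Carrier = ℤ
  ; _≈_ = λ x y → x ≡ y [modℤ q ]
  ; isEquivalence = record { refl = modℤ-refl ; sym = modℤ-sym ; trans = modℤ-trans } }

modℤ-weaken : ∀ {q r x y} → r ∣ q → x ≡ y [modℤ q ] → x ≡ y [modℤ r ]
modℤ-weaken r∣q (modℤ d) = modℤ (∣-trans r∣q d)

module FiniteProduct {A : Set} {_∙_ : A → A → A} {ε : A}
                     (isCommutativeMonoid : IsCommutativeMonoid _≡_ _∙_ ε) where

  open IsCommutativeMonoid isCommutativeMonoid using (assoc; identityˡ; identityʳ)

  commutativeMonoid : CommutativeMonoid 0ℓ 0ℓ
  commutativeMonoid = record { isCommutativeMonoid = isCommutativeMonoid }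

  open CommutativeSemigroupProperties (CommutativeMonoid.commutativeSemigroup commutativeMonoid)
    using (interchange)

  prod : ℕ → (ℕ → A) → A
  prod zero    f = ε
  prod (suc n) f = f 0 ∙ prod n (f ∘ suc)

  prod-preserves : (R : A → A → Set) → R ε ε → (∀ {a b c d} → R a b → R c d → R (a ∙ c) (b ∙ d)) →
                   ∀ n {f g} → (∀ i → i < n → R (f i) (g i)) → R (prod n f) (prod n g)
  prod-preserves R ε-R ∙-R zero    f~g = ε-R
  prod-preserves R ε-R ∙-R (suc n) f~g =
    ∙-R (f~g 0 (s≤s z≤n)) (prod-preserves R ε-R ∙-R n (λ i i<n → f~g (suc i) (s≤s i<n)))

  prod-cong : ∀ n {f g} → (∀ i → i < n → f i ≡ g i) → prod n f ≡ prod n g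
  prod-cong = prod-preserves _≡_ refl (cong₂ _∙_)

  prod-split : ∀ m n f → prod (m ℕ.+ n) f ≡ prod m f ∙ prod n (λ i → f (m ℕ.+ i))
  prod-split zero    n f = sym (identityˡ _)
  prod-split (suc m) n f = trans (cong (f 0 ∙_) (prod-split m n (f ∘ suc))) (sym (assoc _ _ _))

  prod-distrib : ∀ n f g → prod n (λ i → f i ∙ g i) ≡ prod n f ∙ prod n g
  prod-distrib zero    f g = sym (identityˡ ε)
  prod-distrib (suc n) f g =
    trans (cong ((f 0 ∙ g 0) ∙_) (prod-distrib n (f ∘ suc) (g ∘ suc))) (interchange _ _ _ _)

  prod-blocks : ∀ m n f → prod (m ℕ.* n) f ≡ prod m (λ i → prod n (λ j → f (i ℕ.* n ℕ.+ j)))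
  prod-blocks zero    n f = refl
  prod-blocks (suc m) n f = trans (prod-split n (m ℕ.* n) f) (cong (prod n f ∙_)
    (trans (prod-blocks m n (λ i → f (n ℕ.+ i)))
           (prod-cong m (λ i _ → prod-cong n (λ j _ → cong f (sym (ℕP.+-assoc n (i ℕ.* n) j)))))))

  prod-snoc : ∀ n f → prod (suc n) f ≡ prod n f ∙ f n
  prod-snoc n f = begin
    prod (suc n) f               ≡⟨ cong (λ k → prod k f) (ℕP.+-comm 1 n) ⟩
    prod (n ℕ.+ 1) f             ≡⟨ prod-split n 1 f ⟩
    prod n f ∙ (f (n ℕ.+ 0) ∙ ε) ≡⟨ cong (λ x → prod n f ∙ x) (identityʳ _) ⟩
    prod n f ∙ f (n ℕ.+ 0)       ≡⟨ cong (λ k → prod n f ∙ f k) (ℕP.+-identityʳ n) ⟩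
    prod n f ∙ f n ∎
    where open ≡-Reasoning

  prod-rotate : ∀ n f → f 0 ≡ ε → f n ≡ ε → prod n (f ∘ suc) ≡ prod n f
  prod-rotate n f f0≡ε fn≡ε = begin
    prod n (f ∘ suc)     ≡⟨ sym (identityˡ _) ⟩
    ε ∙ prod n (f ∘ suc) ≡⟨ cong (_∙ prod n (f ∘ suc)) (sym f0≡ε) ⟩
    prod (suc n) f       ≡⟨ prod-snoc n f ⟩
    prod n f ∙ f n       ≡⟨ cong (prod n f ∙_) fn≡ε ⟩
    prod n f ∙ ε         ≡⟨ identityʳ _ ⟩
    prod n f ∎
    where open ≡-Reasoning

  prod-permute : ∀ n f (σ τ : ℕ → ℕ) →
                 (∀ i → i < n → σ i < n) → (∀ i → i < n → τ i < n) →
                 (∀ i → i < n → σ (τ i) ≡ i) → (∀ i → i < n → τ (σ i) ≡ i) →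
                 prod n f ≡ prod n (f ∘ σ)
  prod-permute n f σ τ σ< τ< στ τσ = begin
    prod n f                       ≡⟨ asSum n f ⟩
    sum {n} (λ i → f (toℕ i))      ≡⟨ sum-permute (λ i → f (toℕ i)) π ⟩
    sum {n} (λ i → f (toℕ (σ′ i))) ≡⟨ sum-cong-≗ {n} (λ i → cong f (FinP.toℕ-fromℕ< _)) ⟩
    sum {n} (λ i → f (σ (toℕ i)))  ≡⟨ sym (asSum n (f ∘ σ)) ⟩
    prod n (f ∘ σ) ∎
    where
    open ≡-Reasoning
    open MonoidSum commutativeMonoid using (sum; sum-permute; sum-cong-≗)
    asSum : ∀ n g → prod n g ≡ sum {n} (λ i → g (toℕ i))
    asSum zero    g = refl
    asSum (suc n) g = cong (g 0 ∙_) (asSum n (g ∘ suc))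
    σ′ τ′ : Fin n → Fin n
    σ′ i = fromℕ< (σ< (toℕ i) (FinP.toℕ<n i))
    τ′ i = fromℕ< (τ< (toℕ i) (FinP.toℕ<n i))
    σ′τ′ : ∀ i → σ′ (τ′ i) ≡ i
    σ′τ′ i = FinP.toℕ-injective (trans (FinP.toℕ-fromℕ< _)
      (trans (cong σ (FinP.toℕ-fromℕ< _)) (στ (toℕ i) (FinP.toℕ<n i))))
    τ′σ′ : ∀ i → τ′ (σ′ i) ≡ i
    τ′σ′ i = FinP.toℕ-injective (trans (FinP.toℕ-fromℕ< _)
      (trans (cong τ (FinP.toℕ-fromℕ< _)) (τσ (toℕ i) (FinP.toℕ<n i))))
    π : Permutation n n
    π = permutation σ′ τ′ σ′τ′ τ′σ′

module ℤ∏ = FiniteProduct ℤP.*-1-isCommutativeMonoid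
open ℤ∏ using (prod; prod-cong)

prod-const : ∀ n c → prod n (λ _ → c) ≡ c ^ n
prod-const zero    c = refl
prod-const (suc n) c = cong (c *_) (prod-const n c)

prod-modℤ : ∀ {q} n {f g} → (∀ i → i < n → f i ≡ g i [modℤ q ]) → prod n f ≡ prod n g [modℤ q ]
prod-modℤ {q} = ℤ∏.prod-preserves (λ x y → x ≡ y [modℤ q ]) modℤ-refl modℤ-*

prod-ones : ∀ n {f} → (∀ i → i < n → f i ≡ 1ℤ) → prod n f ≡ 1ℤ
prod-ones n {f} f≡1 = trans (prod-cong n f≡1) (trans (prod-const n 1ℤ) (ℤP.^-zeroˡ n))

module _ {p : ℕ} (p-prime : Prime p) where

  1-indivisible : ¬ + p ∣ 1ℤ
  1-indivisible p∣1 = ℕ.nonTrivial⇒≢1 {{prime⇒nonTrivial p-prime}} (ℕD.∣1⇒≡1 (∣⇒∣ᵤ p∣1))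

  *-indivisible : ∀ {a b} → ¬ + p ∣ a → ¬ + p ∣ b → ¬ + p ∣ a * b
  *-indivisible {a} {b} p∤a p∤b p∣ab
    with euclidsLemma ∣ a ∣ ∣ b ∣ p-prime (subst (p ℕD.∣_) (ℤP.abs-* a b) (∣⇒∣ᵤ p∣ab))
  ... | inj₁ p∣a = p∤a (∣ᵤ⇒∣ p∣a)
  ... | inj₂ p∣b = p∤b (∣ᵤ⇒∣ p∣b)

  prod-indivisible : ∀ n {f} → (∀ i → i < n → ¬ + p ∣ f i) → ¬ + p ∣ prod n f
  prod-indivisible zero    _   = 1-indivisible
  prod-indivisible (suc n) p∤f =
    *-indivisible (p∤f 0 (s≤s z≤n)) (prod-indivisible n (λ i i<n → p∤f (suc i) (s≤s i<n)))

  ^-cancel-indivisible : ∀ s {a z} → ¬ p ℕD.∣ a → (p ℕ.^ s) ℕD.∣ (a ℕ.* z) → (p ℕ.^ s) ℕD.∣ z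
  ^-cancel-indivisible zero    {z = z} _ _ = ℕD.1∣ z
  ^-cancel-indivisible (suc s) {a} {z} p∤a pˢ⁺¹∣az
    with euclidsLemma a z p-prime (ℕD.∣-trans (ℕD.m∣m*n (p ℕ.^ s)) pˢ⁺¹∣az)
  ... | inj₁ p∣a = ⊥-elim (p∤a p∣a)
  ... | inj₂ (ℕD.divides z′ refl) =
    subst (p ℕ.^ suc s ℕD.∣_) (ℕP.*-comm p z′) (ℕD.*-monoʳ-∣ p (^-cancel-indivisible s p∤a pˢ∣az′))
    where
    instance _ = prime⇒nonZero p-prime
    rearrange : ∀ a z′ p → a ℕ.* (z′ ℕ.* p) ≡ p ℕ.* (a ℕ.* z′)
    rearrange = ℕSolver.solve-∀
    pˢ∣az′ : (p ℕ.^ s) ℕD.∣ (a ℕ.* z′)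
    pˢ∣az′ = ℕD.*-cancelˡ-∣ p (subst (p ℕ.* p ℕ.^ s ℕD.∣_) (rearrange a z′ p) pˢ⁺¹∣az)

  ^-indivisible : ∀ {a} → ¬ p ℕD.∣ a → ∀ n → ¬ p ℕD.∣ a ℕ.^ n
  ^-indivisible p∤a zero    p∣1   = 1-indivisible (∣ᵤ⇒∣ p∣1)
  ^-indivisible {a} p∤a (suc n) p∣aaⁿ with euclidsLemma a (a ℕ.^ n) p-prime p∣aaⁿ
  ... | inj₁ p∣a  = p∤a p∣a
  ... | inj₂ p∣aⁿ = ^-indivisible p∤a n p∣aⁿ

  modℤ-cancel : ∀ s a {x y} → ¬ + p ∣ a → a * x ≡ a * y [modℤ + (p ℕ.^ s) ] → x ≡ y [modℤ + (p ℕ.^ s) ]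
  modℤ-cancel s a {x} {y} p∤a (modℤ d) =
    modℤ (∣ᵤ⇒∣ (^-cancel-indivisible s (p∤a ∘ ∣ᵤ⇒∣) (subst (p ℕ.^ s ℕD.∣_) factor (∣⇒∣ᵤ d))))
    where
    factor : ∣ a * x - a * y ∣ ≡ ∣ a ∣ ℕ.* ∣ x - y ∣
    factor = trans (cong ∣_∣ (distrib a x y)) (ℤP.abs-* a (x - y))
      where
      distrib : ∀ a x y → a * x - a * y ≡ a * (x - y)
      distrib = solve-∀

-- Truncated polynomials ℤ[t]/(t³): jet a b c stands for a + b t + c t².
record Jet : Set where
  constructor jet
  field j₀ j₁ j₂ : ℤ
open Jet

jet-≡ : ∀ {a b c a′ b′ c′} → a ≡ a′ → b ≡ b′ → c ≡ c′ → jet a b c ≡ jet a′ b′ c′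
jet-≡ refl refl refl = refl

infixl 7 _⊗_
_⊗_ : Jet → Jet → Jet
jet a b c ⊗ jet a′ b′ c′ = jet (a * a′) (a * b′ + b * a′) (a * c′ + b * b′ + c * a′)

oneⱼ : Jet
oneⱼ = jet 1ℤ 0ℤ 0ℤ

⊗-isCommutativeMonoid : IsCommutativeMonoid _≡_ _⊗_ oneⱼ
⊗-isCommutativeMonoid = record
  { isMonoid = record
    { isSemigroup = record
      { isMagma = record { isEquivalence = isEquivalence ; ∙-cong = cong₂ _⊗_ }
      ; assoc   = assoc }
    ; identity = identityˡ , λ x → trans (comm x oneⱼ) (identityˡ x) }
  ; comm = comm }
  where
  assoc : ∀ x y z → x ⊗ y ⊗ z ≡ x ⊗ (y ⊗ z)
  assoc (jet a b c) (jet a′ b′ c′) (jet a″ b″ c″) =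
    jet-≡ (ℤP.*-assoc a a′ a″) (assoc₁ a b a′ b′ a″ b″) (assoc₂ a b c a′ b′ c′ a″ b″ c″)
    where
    assoc₁ : ∀ a b a′ b′ a″ b″ →
             a * a′ * b″ + (a * b′ + b * a′) * a″ ≡ a * (a′ * b″ + b′ * a″) + b * (a′ * a″)
    assoc₁ = solve-∀
    assoc₂ : ∀ a b c a′ b′ c′ a″ b″ c″ →
             a * a′ * c″ + (a * b′ + b * a′) * b″ + (a * c′ + b * b′ + c * a′) * a″ ≡
             a * (a′ * c″ + b′ * b″ + c′ * a″) + b * (a′ * b″ + b′ * a″) + c * (a′ * a″)
    assoc₂ = solve-∀
  comm : ∀ x y → x ⊗ y ≡ y ⊗ x
  comm (jet a b c) (jet a′ b′ c′) = jet-≡ (ℤP.*-comm a a′) (comm₁ a b a′ b′) (comm₂ a b c a′ b′ c′)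
    where
    comm₁ : ∀ a b a′ b′ → a * b′ + b * a′ ≡ a′ * b + b′ * a
    comm₁ = solve-∀
    comm₂ : ∀ a b c a′ b′ c′ → a * c′ + b * b′ + c * a′ ≡ a′ * c + b′ * b + c′ * a
    comm₂ = solve-∀
  identityˡ : ∀ x → oneⱼ ⊗ x ≡ x
  identityˡ (jet a b c) = jet-≡ (ℤP.*-identityˡ a) (identity₁ a b) (identity₂ a b c)
    where
    identity₁ : ∀ a b → 1ℤ * b + 0ℤ * a ≡ b
    identity₁ = solve-∀
    identity₂ : ∀ a b c → 1ℤ * c + 0ℤ * b + 0ℤ * a ≡ c
    identity₂ = solve-∀

module Jet∏ = FiniteProduct ⊗-isCommutativeMonoid

eval : Jet → ℤ → ℤ
eval (jet a b c) t = a + b * t + c * (t * t)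

eval-⊗ : ∀ x y t → ∃ λ r → eval x t * eval y t ≡ eval (x ⊗ y) t + t * t * t * r
eval-⊗ (jet a b c) (jet a′ b′ c′) t = b * c′ + c * b′ + c * c′ * t , expand a b c a′ b′ c′ t
  where
  expand : ∀ a b c a′ b′ c′ t →
           (a + b * t + c * (t * t)) * (a′ + b′ * t + c′ * (t * t)) ≡
           a * a′ + (a * b′ + b * a′) * t + (a * c′ + b * b′ + c * a′) * (t * t)
             + t * t * t * (b * c′ + c * b′ + c * c′ * t)
  expand = solve-∀

eval-prod : ∀ n f t → ∃ λ r → prod n (λ i → eval (f i) t) ≡ eval (Jet∏.prod n f) t + t * t * t * r
eval-prod zero    f t = 0ℤ , unit t
  where
  unit : ∀ t → 1ℤ ≡ 1ℤ + 0ℤ * t + 0ℤ * (t * t) + t * t * t * 0ℤ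
  unit = solve-∀
eval-prod (suc n) f t = r′ + e * r , trans (cong (e *_) (proj₂ (eval-prod n (f ∘ suc) t))) (absorb e v w r r′ t ⊗≡)
  where
  e v w r r′ : ℤ
  e = eval (f 0) t
  v = eval (Jet∏.prod n (f ∘ suc)) t
  w = eval (Jet∏.prod (suc n) f) t
  r = proj₁ (eval-prod n (f ∘ suc) t)
  r′ = proj₁ (eval-⊗ (f 0) (Jet∏.prod n (f ∘ suc)) t)
  ⊗≡ : e * v ≡ w + t * t * t * r′
  ⊗≡ = proj₂ (eval-⊗ (f 0) (Jet∏.prod n (f ∘ suc)) t)
  absorb : ∀ e v w r r′ t → e * v ≡ w + t * t * t * r′ → e * (v + t * t * t * r) ≡ w + t * t * t * (r′ + e * r)
  absorb e v w r r′ t ev≡ = begin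
    e * (v + t * t * t * r)                  ≡⟨ distrib e v r t ⟩
    e * v + t * t * t * (e * r)              ≡⟨ cong (_+ t * t * t * (e * r)) ev≡ ⟩
    w + t * t * t * r′ + t * t * t * (e * r) ≡⟨ collect w r′ (e * r) t ⟩
    w + t * t * t * (r′ + e * r) ∎
    where
    open ≡-Reasoning
    distrib : ∀ e v r t → e * (v + t * t * t * r) ≡ e * v + t * t * t * (e * r)
    distrib = solve-∀
    collect : ∀ w r r′ t → w + t * t * t * r + t * t * t * r′ ≡ w + t * t * t * (r + r′)
    collect = solve-∀

j₀-prod : ∀ n f → j₀ (Jet∏.prod n f) ≡ prod n (j₀ ∘ f)
j₀-prod zero    f = refl
j₀-prod (suc n) f = cong (j₀ (f 0) *_) (j₀-prod n (f ∘ suc))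

dilate : ℤ → Jet → Jet
dilate c (jet a b d) = jet a (c * b) (c * c * d)

dilate-⊗ : ∀ c x y → dilate c (x ⊗ y) ≡ dilate c x ⊗ dilate c y
dilate-⊗ c (jet a b d) (jet a′ b′ d′) = jet-≡ refl (linear c a b a′ b′) (quadratic c a b d a′ b′ d′)
  where
  linear : ∀ c a b a′ b′ → c * (a * b′ + b * a′) ≡ a * (c * b′) + c * b * a′
  linear = solve-∀
  quadratic : ∀ c a b d a′ b′ d′ → c * c * (a * d′ + b * b′ + d * a′) ≡
              a * (c * c * d′) + c * b * (c * b′) + c * c * d * a′
  quadratic = solve-∀

dilate-prod : ∀ c n f → dilate c (Jet∏.prod n f) ≡ Jet∏.prod n (dilate c ∘ f)
dilate-prod c zero    f = jet-≡ refl (ℤP.*-zeroʳ c) (ℤP.*-zeroʳ (c * c))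
dilate-prod c (suc n) f = trans (dilate-⊗ c (f 0) _) (cong (dilate c (f 0) ⊗_) (dilate-prod c n (f ∘ suc)))

infixr 8 _·ⱼ_
_·ⱼ_ : ℤ → Jet → Jet
k ·ⱼ jet a b c = jet (k * a) (k * b) (k * c)

·ⱼ-⊗ : ∀ k l x y → (k ·ⱼ x) ⊗ (l ·ⱼ y) ≡ (k * l) ·ⱼ (x ⊗ y)
·ⱼ-⊗ k l (jet a b c) (jet a′ b′ c′) = jet-≡ (degree0 k l a a′) (degree1 k l a b a′ b′) (degree2 k l a b c a′ b′ c′)
  where
  degree0 : ∀ k l a a′ → k * a * (l * a′) ≡ k * l * (a * a′)
  degree0 = solve-∀
  degree1 : ∀ k l a b a′ b′ → k * a * (l * b′) + k * b * (l * a′) ≡ k * l * (a * b′ + b * a′)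
  degree1 = solve-∀
  degree2 : ∀ k l a b c a′ b′ c′ → k * a * (l * c′) + k * b * (l * b′) + k * c * (l * a′) ≡
            k * l * (a * c′ + b * b′ + c * a′)
  degree2 = solve-∀

prod-·ⱼ : ∀ n κ f → Jet∏.prod n (λ i → κ i ·ⱼ f i) ≡ prod n κ ·ⱼ Jet∏.prod n f
prod-·ⱼ zero    κ f = jet-≡ refl refl refl
prod-·ⱼ (suc n) κ f = trans (cong (κ 0 ·ⱼ f 0 ⊗_) (prod-·ⱼ n (κ ∘ suc) (f ∘ suc))) (·ⱼ-⊗ (κ 0) _ (f 0) _)

infix 4 _≡_[modⱼ_]
record _≡_[modⱼ_] (x y : Jet) (q : ℤ) : Set where
  constructor modⱼ
  field
    mod₀ : j₀ x ≡ j₀ y [modℤ q ]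
    mod₁ : j₁ x ≡ j₁ y [modℤ q ]
    mod₂ : j₂ x ≡ j₂ y [modℤ q ]
open _≡_[modⱼ_]

prod-modⱼ : ∀ {q} n {f g} → (∀ i → i < n → f i ≡ g i [modⱼ q ]) → Jet∏.prod n f ≡ Jet∏.prod n g [modⱼ q ]
prod-modⱼ {q} = Jet∏.prod-preserves (λ x y → x ≡ y [modⱼ q ]) (modⱼ modℤ-refl modℤ-refl modℤ-refl) ⊗-modⱼ
  where
  ⊗-modⱼ : ∀ {x x′ y y′} → x ≡ x′ [modⱼ q ] → y ≡ y′ [modⱼ q ] → x ⊗ y ≡ x′ ⊗ y′ [modⱼ q ]
  ⊗-modⱼ {jet _ _ _} {jet _ _ _} {jet _ _ _} {jet _ _ _} (modⱼ a b c) (modⱼ a′ b′ c′) =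
    modⱼ (modℤ-* a a′) (modℤ-+ (modℤ-* a b′) (modℤ-* b a′))
         (modℤ-+ (modℤ-+ (modℤ-* a c′) (modℤ-* b b′)) (modℤ-* c a′))

binomial-factorials : ∀ r m → ((r ℕ.+ m) C m) ℕ.* (m ! ℕ.* r !) ≡ (r ℕ.+ m) !
binomial-factorials r m = begin
  ((r ℕ.+ m) C m) ℕ.* (m ! ℕ.* r !)         ≡⟨ cong (λ k → ((r ℕ.+ m) C m) ℕ.* (m ! ℕ.* k !)) (sym m+r∸m≡r) ⟩
  ((r ℕ.+ m) C m) ℕ.* denominator           ≡⟨ cong (ℕ._* denominator) (nCk≡n!/k![n-k]! m≤r+m) ⟩
  (r ℕ.+ m) ! / denominator ℕ.* denominator ≡⟨ m/n*n≡m (k![n∸k]!∣n! m≤r+m) ⟩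
  (r ℕ.+ m) ! ∎
  where
  open ≡-Reasoning
  m≤r+m : m ≤ r ℕ.+ m
  m≤r+m = ℕP.m≤n+m m r
  m+r∸m≡r : r ℕ.+ m ∸ m ≡ r
  m+r∸m≡r = ℕP.m+n∸n≡m r m
  denominator : ℕ
  denominator = m ! ℕ.* (r ℕ.+ m ∸ m) !
  instance _ = m !* (r ℕ.+ m ∸ m) !≢0

factorial-prod : ∀ n → + (n !) ≡ prod n (λ j → + suc j)
factorial-prod zero    = refl
factorial-prod (suc n) = begin
  + (suc n ℕ.* n !)                ≡⟨ ℤP.pos-* (suc n) (n !) ⟩
  + suc n * + (n !)                ≡⟨ ℤP.*-comm (+ suc n) _ ⟩
  + (n !) * + suc n                ≡⟨ cong (_* + suc n) (factorial-prod n) ⟩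
  prod n (λ j → + suc j) * + suc n ≡⟨ sym (ℤ∏.prod-snoc n _) ⟩
  prod (suc n) (λ j → + suc j) ∎
  where open ≡-Reasoning

+-^-* : ∀ m n k → + (m ℕ.^ (k ℕ.* n)) ≡ (+ (m ℕ.^ n)) ^ k
+-^-* m n zero    = refl
+-^-* m n (suc k) = begin
  + (m ℕ.^ (n ℕ.+ k ℕ.* n))         ≡⟨ cong +_ (ℕP.^-distribˡ-+-* m n (k ℕ.* n)) ⟩
  + (m ℕ.^ n ℕ.* m ℕ.^ (k ℕ.* n))   ≡⟨ ℤP.pos-* (m ℕ.^ n) _ ⟩
  + (m ℕ.^ n) * + (m ℕ.^ (k ℕ.* n)) ≡⟨ cong (+ (m ℕ.^ n) *_) (+-^-* m n k) ⟩
  + (m ℕ.^ n) * (+ (m ℕ.^ n)) ^ k ∎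
  where open ≡-Reasoning

^2≡square : ∀ x → x ^ 2 ≡ x * x
^2≡square x = cong (x *_) (ℤP.*-identityʳ x)

^3≡cube : ∀ x → x ^ 3 ≡ x * (x * x)
^3≡cube x = cong (λ y → x * (x * y)) (ℤP.*-identityʳ x)

odd≡1+2*half : ∀ {n} → ¬ 2 ℕD.∣ n → n ≡ suc (2 ℕ.* (n / 2))
odd≡1+2*half {n} 2∤n with n % 2 | ℕDM.m%n<n n 2 | ℕDM.m≡m%n+[m/n]*n n 2
... | 0           | _            | n≡[n/2]*2   = ⊥-elim (2∤n (ℕD.divides (n / 2) n≡[n/2]*2))
... | 1           | _            | n≡1+[n/2]*2 = trans n≡1+[n/2]*2 (cong suc (ℕP.*-comm (n / 2) 2))
... | suc (suc _) | s≤s (s≤s ()) | _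

module PrimePower {p : ℕ} (p-prime : Prime p) (s : ℕ) where

  instance
    p≢0 : NonZero p
    p≢0 = prime⇒nonZero p-prime

  Q P : ℕ
  Q = p ℕ.^ s
  P = p ℕ.* Q

  instance
    P≢0 : NonZero P
    P≢0 = ℕP.m*n≢0 p Q ⦃ p≢0 ⦄ ⦃ ℕP.m^n≢0 p s ⦄

  p∣P : p ℕD.∣ P
  p∣P = ℕD.m∣m*n Q

  p∤1+j : ∀ {j} → j < ℕ.pred p → ¬ p ℕD.∣ suc j
  p∤1+j {j} j<p′ p∣1+j = ℕP.<⇒≱ (subst (suc j <_) (ℕP.suc-pred p) (s≤s j<p′)) (ℕD.∣⇒≤ p∣1+j)

  ifDivisible : {A : Set} → ℕ → A → A → A
  ifDivisible j a b = if does (p ℕD.∣? j) then a else b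

  module _ {A : Set} {a b : A} where

    ifDivisible-yes : ∀ {j} → p ℕD.∣ j → ifDivisible j a b ≡ a
    ifDivisible-yes {j} p∣j rewrite dec-true (p ℕD.∣? j) p∣j = refl

    ifDivisible-no : ∀ {j} → ¬ p ℕD.∣ j → ifDivisible j a b ≡ b
    ifDivisible-no {j} p∤j rewrite dec-false (p ℕD.∣? j) p∤j = refl

    ifDivisible-⇔ : ∀ {j k} → (p ℕD.∣ j → p ℕD.∣ k) → (p ℕD.∣ k → p ℕD.∣ j) →
                    ifDivisible j a b ≡ ifDivisible k a b
    ifDivisible-⇔ {j} {k} to from =
      cong (λ d → if d then a else b) (does-⇔ (mk⇔ to from) (p ℕD.∣? j) (p ℕD.∣? k))

    ifDivisible-+multiple : ∀ {m j} → p ℕD.∣ m → ifDivisible (m ℕ.+ j) a b ≡ ifDivisible j a b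
    ifDivisible-+multiple p∣m = ifDivisible-⇔ (λ p∣m+j → ℕD.∣m+n∣m⇒∣n p∣m+j p∣m) (ℕD.∣m∣n⇒∣m+n p∣m)

  coprimePart multiplePart : (ℕ → ℤ) → ℕ → ℤ
  coprimePart  f j = ifDivisible j 1ℤ (f j)
  multiplePart f j = ifDivisible j (f j) 1ℤ

  coprimePart*multiplePart : ∀ f j → coprimePart f j * multiplePart f j ≡ f j
  coprimePart*multiplePart f j with does (p ℕD.∣? j)
  ... | true  = ℤP.*-identityˡ (f j)
  ... | false = ℤP.*-identityʳ (f j)

  coprimePart-indivisible : ∀ {f} → (∀ j → ¬ p ℕD.∣ j → ¬ + p ∣ f j) → ∀ j → ¬ + p ∣ coprimePart f j
  coprimePart-indivisible p∤f j with p ℕD.∣? j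
  ... | yes _   = 1-indivisible p-prime
  ... | no  p∤j = p∤f j p∤j

  Φ : ℤ → ℤ
  Φ t = prod P (coprimePart (λ u → + u + t))

  coprimeFactorial : ℕ → ℤ
  coprimeFactorial n = prod n (coprimePart (λ n → + n) ∘ suc)

  coprimeFactorial-indivisible : ∀ n → ¬ + p ∣ coprimeFactorial n
  coprimeFactorial-indivisible n =
    prod-indivisible p-prime n (λ j _ → coprimePart-indivisible {λ n → + n} (λ j p∤j → p∤j ∘ ∣⇒∣ᵤ) (suc j))

  coprimeBlock≡Φ : ∀ m → p ℕD.∣ m → prod P (λ j → coprimePart (λ n → + n) (m ℕ.+ suc j)) ≡ Φ (+ m)
  coprimeBlock≡Φ m p∣m = trans (prod-cong P (λ j _ → shift (suc j)))
    (ℤ∏.prod-rotate P (coprimePart (λ u → + u + + m)) (ifDivisible-yes (p ℕD.∣0)) (ifDivisible-yes p∣P))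
    where
    shift : ∀ u → coprimePart (λ n → + n) (m ℕ.+ u) ≡ coprimePart (λ u → + u + + m) u
    shift u = trans (ifDivisible-+multiple p∣m) (cong (ifDivisible u 1ℤ ∘ +_) (ℕP.+-comm m u))

  coprimeFactorial-blocks : ∀ n → coprimeFactorial (n ℕ.* P) ≡ prod n (λ i → Φ (+ (i ℕ.* P)))
  coprimeFactorial-blocks n = trans (ℤ∏.prod-blocks n P _) (prod-cong n (λ i _ →
    trans (prod-cong P (λ j _ → cong (coprimePart (λ n → + n)) (sym (ℕP.+-suc (i ℕ.* P) j))))
          (coprimeBlock≡Φ (i ℕ.* P) (ℕD.∣n⇒∣m*n i p∣P))))

  multipleBlock : ∀ i → prod p (λ j → multiplePart (λ n → + n) (i ℕ.* p ℕ.+ suc j)) ≡ + (p ℕ.* suc i)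
  multipleBlock i = begin
    prod p f             ≡⟨ cong (λ k → prod k f) (sym (ℕP.suc-pred p)) ⟩
    prod (suc p′) f      ≡⟨ ℤ∏.prod-snoc p′ f ⟩
    prod p′ f * f p′     ≡⟨ cong₂ _*_ (prod-ones p′ (λ j j<p′ → ifDivisible-no (p∤ j j<p′))) last ⟩
    1ℤ * + (p ℕ.* suc i) ≡⟨ ℤP.*-identityˡ _ ⟩
    + (p ℕ.* suc i) ∎
    where
    open ≡-Reasoning
    p′ : ℕ
    p′ = ℕ.pred p
    f : ℕ → ℤ
    f j = multiplePart (λ n → + n) (i ℕ.* p ℕ.+ suc j)
    p∤ : ∀ j → j < p′ → ¬ p ℕD.∣ i ℕ.* p ℕ.+ suc j
    p∤ j j<p′ p∣ = p∤1+j j<p′ (ℕD.∣m+n∣m⇒∣n p∣ (ℕD.n∣m*n i))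
    ip+p≡p[1+i] : ∀ i p → i ℕ.* p ℕ.+ p ≡ p ℕ.* suc i
    ip+p≡p[1+i] = ℕSolver.solve-∀
    last : f p′ ≡ + (p ℕ.* suc i)
    last = begin
      multiplePart (λ n → + n) (i ℕ.* p ℕ.+ suc p′)
        ≡⟨ cong (multiplePart (λ n → + n) ∘ (i ℕ.* p ℕ.+_)) (ℕP.suc-pred p) ⟩
      multiplePart (λ n → + n) (i ℕ.* p ℕ.+ p)
        ≡⟨ ifDivisible-yes (ℕD.∣m∣n⇒∣m+n (ℕD.n∣m*n i) ℕD.∣-refl) ⟩
      + (i ℕ.* p ℕ.+ p)
        ≡⟨ cong +_ (ip+p≡p[1+i] i p) ⟩
      + (p ℕ.* suc i) ∎

  multipleFactorial : ℕ → ℕ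
  multipleFactorial m = p ℕ.^ m ℕ.* m !

  multipleFactorial≢0 : ∀ m → NonZero (multipleFactorial m)
  multipleFactorial≢0 m = ℕP.m*n≢0 _ _ ⦃ ℕP.m^n≢0 p m ⦄ ⦃ m !≢0 ⦄

  multipleFactorial-binomial : ∀ r m →
    multipleFactorial (r ℕ.+ m) ≡ ((r ℕ.+ m) C m) ℕ.* (multipleFactorial m ℕ.* multipleFactorial r)
  multipleFactorial-binomial r m = begin
    p ℕ.^ (r ℕ.+ m) ℕ.* (r ℕ.+ m) !
      ≡⟨ cong₂ ℕ._*_ (ℕP.^-distribˡ-+-* p r m) (sym (binomial-factorials r m)) ⟩
    p ℕ.^ r ℕ.* p ℕ.^ m ℕ.* (((r ℕ.+ m) C m) ℕ.* (m ! ℕ.* r !))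
      ≡⟨ reorder ((r ℕ.+ m) C m) (p ℕ.^ m) (p ℕ.^ r) (m !) (r !) ⟩
    ((r ℕ.+ m) C m) ℕ.* (p ℕ.^ m ℕ.* m ! ℕ.* (p ℕ.^ r ℕ.* r !)) ∎
    where
    open ≡-Reasoning
    reorder : ∀ y x x′ f f′ → x′ ℕ.* x ℕ.* (y ℕ.* (f ℕ.* f′)) ≡ y ℕ.* (x ℕ.* f ℕ.* (x′ ℕ.* f′))
    reorder = ℕSolver.solve-∀

  prod-multiples : ∀ m → prod m (λ i → + (p ℕ.* suc i)) ≡ + multipleFactorial m
  prod-multiples zero    = refl
  prod-multiples (suc m) = begin
    prod (suc m) f                        ≡⟨ ℤ∏.prod-snoc m f ⟩
    prod m f * + (p ℕ.* suc m)            ≡⟨ cong (_* + (p ℕ.* suc m)) (prod-multiples m) ⟩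
    + (p ℕ.^ m ℕ.* m !) * + (p ℕ.* suc m) ≡⟨ sym (ℤP.pos-* (p ℕ.^ m ℕ.* m !) (p ℕ.* suc m)) ⟩
    + (p ℕ.^ m ℕ.* m ! ℕ.* (p ℕ.* suc m)) ≡⟨ cong +_ (regroup (p ℕ.^ m) (m !) p m) ⟩
    + (p ℕ.^ suc m ℕ.* suc m !) ∎
    where
    open ≡-Reasoning
    f : ℕ → ℤ
    f i = + (p ℕ.* suc i)
    regroup : ∀ x y p m → x ℕ.* y ℕ.* (p ℕ.* suc m) ≡ p ℕ.* x ℕ.* (suc m ℕ.* y)
    regroup = ℕSolver.solve-∀

  factorial-split : ∀ m → + ((m ℕ.* p) !) ≡ coprimeFactorial (m ℕ.* p) * + multipleFactorial m
  factorial-split m = begin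
    + ((m ℕ.* p) !)
      ≡⟨ factorial-prod (m ℕ.* p) ⟩
    prod (m ℕ.* p) (λ j → + suc j)
      ≡⟨ prod-cong (m ℕ.* p) (λ j _ → sym (coprimePart*multiplePart (λ n → + n) (suc j))) ⟩
    prod (m ℕ.* p) (λ j → coprimePart (λ n → + n) (suc j) * multiplePart (λ n → + n) (suc j))
      ≡⟨ ℤ∏.prod-distrib (m ℕ.* p) _ _ ⟩
    coprimeFactorial (m ℕ.* p) * prod (m ℕ.* p) (multiplePart (λ n → + n) ∘ suc)
      ≡⟨ cong (coprimeFactorial (m ℕ.* p) *_) multiples ⟩
    coprimeFactorial (m ℕ.* p) * + multipleFactorial m ∎
    where
    open ≡-Reasoning
    multiples : prod (m ℕ.* p) (multiplePart (λ n → + n) ∘ suc) ≡ + multipleFactorial m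
    multiples = begin
      prod (m ℕ.* p) (multiplePart (λ n → + n) ∘ suc)
        ≡⟨ ℤ∏.prod-blocks m p _ ⟩
      prod m (λ i → prod p (λ j → multiplePart (λ n → + n) (suc (i ℕ.* p ℕ.+ j))))
        ≡⟨ prod-cong m (λ i _ → block i) ⟩
      prod m (λ i → + (p ℕ.* suc i))
        ≡⟨ prod-multiples m ⟩
      + multipleFactorial m ∎
      where
      block : ∀ i → prod p (λ j → multiplePart (λ n → + n) (suc (i ℕ.* p ℕ.+ j))) ≡ + (p ℕ.* suc i)
      block i = trans (prod-cong p (λ j _ → cong (multiplePart (λ n → + n)) (sym (ℕP.+-suc (i ℕ.* p) j))))
                      (multipleBlock i)

  coprimeFactorial-power : ∀ {q} → (∀ i → Φ (+ (i ℕ.* P)) ≡ Φ 0ℤ [modℤ q ]) →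
                           ∀ n → coprimeFactorial (n ℕ.* P) ≡ Φ 0ℤ ^ n [modℤ q ]
  coprimeFactorial-power Φ-periodic n = modℤ-trans
    (modℤ-reflexive (coprimeFactorial-blocks n))
    (modℤ-trans (prod-modℤ n (λ i _ → Φ-periodic i)) (modℤ-reflexive (prod-const n (Φ 0ℤ))))

  -- Multiply by p^((c+b)Q) (bQ)! (cQ)!: both sides become ((c+b)P)!.
  binomial-exact : ∀ c b →
    + ((c ℕ.* P ℕ.+ b ℕ.* P) C (b ℕ.* P)) * (coprimeFactorial (b ℕ.* P) * coprimeFactorial (c ℕ.* P)) ≡
    coprimeFactorial ((c ℕ.+ b) ℕ.* P) * + ((c ℕ.* Q ℕ.+ b ℕ.* Q) C (b ℕ.* Q))
  binomial-exact c b = ℤP.*-cancelʳ-≡ _ _ (+ (A b ℕ.* A c)) ⦃ ℕP.m*n≢0 (A b) (A c) ⦃ A≢0 b ⦄ ⦃ A≢0 c ⦄ ⦄ (begin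
    + X * (D b * D c) * + (A b ℕ.* A c)       ≡⟨ cong (+ X * (D b * D c) *_) (ℤP.pos-* (A b) (A c)) ⟩
    + X * (D b * D c) * (+ A b * + A c)       ≡⟨ regroup (+ X) (D b) (D c) (+ A b) (+ A c) ⟩
    + X * ((D b * + A b) * (D c * + A c))     ≡⟨ cong₂ (λ u v → + X * (u * v)) (sym (split b)) (sym (split c)) ⟩
    + X * (+ ((b ℕ.* P) !) * + ((c ℕ.* P) !)) ≡⟨ cong (+ X *_) (sym (ℤP.pos-* ((b ℕ.* P) !) _)) ⟩
    + X * + ((b ℕ.* P) ! ℕ.* (c ℕ.* P) !)     ≡⟨ sym (ℤP.pos-* X _) ⟩
    + (X ℕ.* ((b ℕ.* P) ! ℕ.* (c ℕ.* P) !))   ≡⟨ cong +_ (binomial-factorials (c ℕ.* P) (b ℕ.* P)) ⟩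
    + ((c ℕ.* P ℕ.+ b ℕ.* P) !)               ≡⟨ cong (λ n → + (n !)) (sym (ℕP.*-distribʳ-+ P c b)) ⟩
    + (((c ℕ.+ b) ℕ.* P) !)                   ≡⟨ split (c ℕ.+ b) ⟩
    D (c ℕ.+ b) * + A (c ℕ.+ b)               ≡⟨ cong (λ n → D (c ℕ.+ b) * + n) A-binomial ⟩
    D (c ℕ.+ b) * + (Y ℕ.* (A b ℕ.* A c))     ≡⟨ cong (D (c ℕ.+ b) *_) (ℤP.pos-* Y _) ⟩
    D (c ℕ.+ b) * (+ Y * + (A b ℕ.* A c))     ≡⟨ sym (ℤP.*-assoc (D (c ℕ.+ b)) _ _) ⟩
    D (c ℕ.+ b) * + Y * + (A b ℕ.* A c) ∎)
    where
    open ≡-Reasoning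
    D : ℕ → ℤ
    D n = coprimeFactorial (n ℕ.* P)
    A : ℕ → ℕ
    A n = multipleFactorial (n ℕ.* Q)
    A≢0 : ∀ n → NonZero (A n)
    A≢0 n = multipleFactorial≢0 (n ℕ.* Q)
    X Y : ℕ
    X = (c ℕ.* P ℕ.+ b ℕ.* P) C (b ℕ.* P)
    Y = (c ℕ.* Q ℕ.+ b ℕ.* Q) C (b ℕ.* Q)
    nP≡nQp : ∀ n Q p → n ℕ.* (p ℕ.* Q) ≡ n ℕ.* Q ℕ.* p
    nP≡nQp = ℕSolver.solve-∀
    split : ∀ n → + ((n ℕ.* P) !) ≡ D n * + A n
    split n = subst (λ m → + (m !) ≡ coprimeFactorial m * + A n) (sym (nP≡nQp n Q p)) (factorial-split (n ℕ.* Q))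
    regroup : ∀ x d d′ a a′ → x * (d * d′) * (a * a′) ≡ x * ((d * a) * (d′ * a′))
    regroup = solve-∀
    A-binomial : A (c ℕ.+ b) ≡ Y ℕ.* (A b ℕ.* A c)
    A-binomial = trans (cong multipleFactorial (ℕP.*-distribʳ-+ Q c b)) (multipleFactorial-binomial (c ℕ.* Q) (b ℕ.* Q))

  binomial-step : ∀ e → (∀ i → Φ (+ (i ℕ.* P)) ≡ Φ 0ℤ [modℤ + (p ℕ.^ e) ]) → ∀ c b →
    + ((c ℕ.* P ℕ.+ b ℕ.* P) C (b ℕ.* P)) ≡ + ((c ℕ.* Q ℕ.+ b ℕ.* Q) C (b ℕ.* Q)) [modℤ + (p ℕ.^ e) ]
  binomial-step e Φ-periodic c b = modℤ-cancel p-prime e (D b * D c) D-indivisible (begin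
    D b * D c * X           ≡⟨ ℤP.*-comm (D b * D c) X ⟩
    X * (D b * D c)         ≡⟨ binomial-exact c b ⟩
    D (c ℕ.+ b) * Y         ≈⟨ modℤ-*ʳ Y (power (c ℕ.+ b)) ⟩
    Φ 0ℤ ^ (c ℕ.+ b) * Y    ≡⟨ cong (_* Y) (ℤP.^-distribˡ-+-* (Φ 0ℤ) c b) ⟩
    Φ 0ℤ ^ c * Φ 0ℤ ^ b * Y ≡⟨ cong (_* Y) (ℤP.*-comm (Φ 0ℤ ^ c) _) ⟩
    Φ 0ℤ ^ b * Φ 0ℤ ^ c * Y ≈⟨ modℤ-*ʳ Y (modℤ-sym (modℤ-* (power b) (power c))) ⟩
    D b * D c * Y ∎)
    where
    open SetoidReasoning (modℤ-setoid (+ (p ℕ.^ e)))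
    D : ℕ → ℤ
    D n = coprimeFactorial (n ℕ.* P)
    X Y : ℤ
    X = + ((c ℕ.* P ℕ.+ b ℕ.* P) C (b ℕ.* P))
    Y = + ((c ℕ.* Q ℕ.+ b ℕ.* Q) C (b ℕ.* Q))
    power : ∀ n → D n ≡ Φ 0ℤ ^ n [modℤ + (p ℕ.^ e) ]
    power = coprimeFactorial-power Φ-periodic
    D-indivisible : ¬ + p ∣ D b * D c
    D-indivisible = *-indivisible p-prime (coprimeFactorial-indivisible (b ℕ.* P)) (coprimeFactorial-indivisible (c ℕ.* P))

  sign : ℕ → ℤ
  sign u = ifDivisible u 1ℤ -1ℤ

  reflect : ℕ → ℕ
  reflect zero    = zero
  reflect (suc u) = P ∸ suc u

  reflect-< : ∀ u → u < P → reflect u < P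
  reflect-< zero    0<P   = 0<P
  reflect-< (suc u) 1+u<P = ℕP.∸-monoʳ-< {P} {suc u} {0} (s≤s z≤n) (ℕP.<⇒≤ 1+u<P)

  reflect-involutive : ∀ u → u < P → reflect (reflect u) ≡ u
  reflect-involutive zero    _     = refl
  reflect-involutive (suc u) 1+u<P with P ∸ suc u | ℕP.m<n⇒0<n∸m 1+u<P | ℕP.m∸[m∸n]≡n (ℕP.<⇒≤ 1+u<P)
  ... | suc v | _ | P∸[P∸[1+u]]≡1+u = P∸[P∸[1+u]]≡1+u

  Φ-reflect-factor : ∀ u → u < P →
    coprimePart (λ u → + u + 0ℤ) (reflect u) ≡ sign u * coprimePart (λ u → + u + - + P) u
  Φ-reflect-factor zero    _     rewrite dec-true (p ℕD.∣? 0) (p ℕD.∣0) = refl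
  Φ-reflect-factor (suc u) 1+u<P = trans (ifDivisible-⇔ to from) (byCases (does (p ℕD.∣? suc u)))
    where
    1+u≤P : suc u ≤ P
    1+u≤P = ℕP.<⇒≤ 1+u<P
    P≡[P∸[1+u]]+[1+u] : P ≡ P ∸ suc u ℕ.+ suc u
    P≡[P∸[1+u]]+[1+u] = sym (ℕP.m∸n+n≡m 1+u≤P)
    to : p ℕD.∣ P ∸ suc u → p ℕD.∣ suc u
    to p∣P∸[1+u] = ℕD.∣m+n∣m⇒∣n (subst (p ℕD.∣_) P≡[P∸[1+u]]+[1+u] p∣P) p∣P∸[1+u]
    from : p ℕD.∣ suc u → p ℕD.∣ P ∸ suc u
    from p∣1+u = ℕD.∣m+n∣m⇒∣n (subst (p ℕD.∣_) (trans P≡[P∸[1+u]]+[1+u] (ℕP.+-comm _ (suc u))) p∣P) p∣1+u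
    P∸[1+u] : + (P ∸ suc u) ≡ + P - + suc u
    P∸[1+u] = trans (sym (ℤP.⊖-≥ 1+u≤P)) (sym (ℤP.m-n≡m⊖n P (suc u)))
    negate : ∀ P u → P - u + 0ℤ ≡ -1ℤ * (u + - P)
    negate = solve-∀
    byCases : ∀ d → (if d then 1ℤ else (+ (P ∸ suc u) + 0ℤ)) ≡
                    (if d then 1ℤ else -1ℤ) * (if d then 1ℤ else (+ suc u + - + P))
    byCases true  = refl
    byCases false = trans (cong (_+ 0ℤ) P∸[1+u]) (negate (+ P) (+ suc u))

  Φ-reflection : Φ 0ℤ ≡ prod P sign * Φ (- + P)
  Φ-reflection = begin
    Φ 0ℤ
      ≡⟨ ℤ∏.prod-permute P _ reflect reflect reflect-< reflect-< reflect-involutive reflect-involutive ⟩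
    prod P (coprimePart (λ u → + u + 0ℤ) ∘ reflect)
      ≡⟨ prod-cong P Φ-reflect-factor ⟩
    prod P (λ u → sign u * coprimePart (λ u → + u + - + P) u)
      ≡⟨ ℤ∏.prod-distrib P sign _ ⟩
    prod P sign * Φ (- + P) ∎
    where open ≡-Reasoning

  sign-product : prod P sign ≡ -1ℤ ^ (ℕ.pred p ℕ.* Q)
  sign-product = begin
    prod P sign
      ≡⟨ cong (λ n → prod n sign) (ℕP.*-comm p Q) ⟩
    prod (Q ℕ.* p) sign
      ≡⟨ ℤ∏.prod-blocks Q p sign ⟩
    prod Q (λ i → prod p (λ j → sign (i ℕ.* p ℕ.+ j)))
      ≡⟨ prod-cong Q (λ i _ → prod-cong p (λ j _ → ifDivisible-+multiple (ℕD.n∣m*n i))) ⟩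
    prod Q (λ _ → prod p sign)
      ≡⟨ prod-const Q (prod p sign) ⟩
    prod p sign ^ Q
      ≡⟨ cong (_^ Q) first-block ⟩
    (-1ℤ ^ ℕ.pred p) ^ Q
      ≡⟨ ℤP.^-*-assoc -1ℤ (ℕ.pred p) Q ⟩
    -1ℤ ^ (ℕ.pred p ℕ.* Q) ∎
    where
    open ≡-Reasoning
    first-block : prod p sign ≡ -1ℤ ^ ℕ.pred p
    first-block = begin
      prod p sign
        ≡⟨ cong (λ n → prod n sign) (sym (ℕP.suc-pred p)) ⟩
      sign 0 * prod (ℕ.pred p) (sign ∘ suc)
        ≡⟨ cong₂ _*_ (ifDivisible-yes (p ℕD.∣0)) (prod-cong (ℕ.pred p) (λ j j<p′ → ifDivisible-no (p∤1+j j<p′))) ⟩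
      1ℤ * prod (ℕ.pred p) (λ _ → -1ℤ)
        ≡⟨ ℤP.*-identityˡ _ ⟩
      prod (ℕ.pred p) (λ _ → -1ℤ)
        ≡⟨ prod-const (ℕ.pred p) -1ℤ ⟩
      -1ℤ ^ ℕ.pred p ∎

  Φ-symmetric : ∀ h → ℕ.pred p ℕ.* Q ≡ h ℕ.+ h → Φ 0ℤ ≡ Φ (- + P)
  Φ-symmetric h even = begin
    Φ 0ℤ
      ≡⟨ Φ-reflection ⟩
    prod P sign * Φ (- + P)
      ≡⟨ cong (_* Φ (- + P)) (trans sign-product (cong (-1ℤ ^_) even)) ⟩
    -1ℤ ^ (h ℕ.+ h) * Φ (- + P)
      ≡⟨ cong (_* Φ (- + P)) (trans (cong (-1ℤ ^_) h+h≡2h) (sym (ℤP.^-*-assoc -1ℤ 2 h))) ⟩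
    1ℤ ^ h * Φ (- + P)
      ≡⟨ cong (_* Φ (- + P)) (ℤP.^-zeroˡ h) ⟩
    1ℤ * Φ (- + P)
      ≡⟨ ℤP.*-identityˡ _ ⟩
    Φ (- + P) ∎
    where
    open ≡-Reasoning
    h+h≡2h : h ℕ.+ h ≡ 2 ℕ.* h
    h+h≡2h = cong (h ℕ.+_) (sym (ℕP.+-identityʳ h))

  unitJet : ℕ → Jet
  unitJet u = ifDivisible u oneⱼ (jet (+ u) 1ℤ 0ℤ)

  ΦJet : Jet
  ΦJet = Jet∏.prod P unitJet

  j₀ΦJet-indivisible : ¬ + p ∣ j₀ ΦJet
  j₀ΦJet-indivisible rewrite j₀-prod P unitJet = prod-indivisible p-prime P (λ u _ → factor u)
    where
    factor : ∀ u → ¬ + p ∣ j₀ (unitJet u)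
    factor u with p ℕD.∣? u
    ... | yes _   = 1-indivisible p-prime
    ... | no  p∤u = p∤u ∘ ∣⇒∣ᵤ

  Φ-expansion : ∀ t → ∃ λ r → Φ t ≡ eval ΦJet t + t * t * t * r
  Φ-expansion t = proj₁ (eval-prod P unitJet t) , trans (prod-cong P (λ u _ → factor u)) (proj₂ (eval-prod P unitJet t))
    where
    one≡ : ∀ t → 1ℤ ≡ 1ℤ + 0ℤ * t + 0ℤ * (t * t)
    one≡ = solve-∀
    linear≡ : ∀ u t → u + t ≡ u + 1ℤ * t + 0ℤ * (t * t)
    linear≡ = solve-∀
    factor : ∀ u → coprimePart (λ u → + u + t) u ≡ eval (unitJet u) t
    factor u with does (p ℕD.∣? u)
    ... | true  = one≡ t
    ... | false = linear≡ (+ u) t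

  -- Φ(t) = e₀ + e₁ t + e₂ t² mod t³, and Φ(0) − Φ(−P) = e₁ P − e₂ P² mod P³ eliminates e₁.
  Φ-difference : ∀ i → ∃ λ R → Φ (+ (i ℕ.* P)) - Φ 0ℤ ≡
    (+ i + + i * + i) * (j₂ ΦJet * (+ P * + P)) + + P * (+ P * + P) * R + + i * (Φ 0ℤ - Φ (- + P))
  Φ-difference i = R , (begin
    Φ (+ (i ℕ.* P)) - Φ 0ℤ
      ≡⟨ cong₂ _-_ (trans (cong Φ (ℤP.pos-* i P)) Φ[iP]) Φ[0] ⟩
    eval ΦJet (I * P′) + I * P′ * (I * P′) * (I * P′) * r - (eval ΦJet 0ℤ + 0ℤ * 0ℤ * 0ℤ * r₀)
      ≡⟨ identity e₀ e₁ e₂ r r₀ r₁ I P′ ⟩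
    shape (eval ΦJet 0ℤ + 0ℤ * 0ℤ * 0ℤ * r₀ - (eval ΦJet (- P′) + - P′ * - P′ * - P′ * r₁))
      ≡⟨ cong shape (cong₂ _-_ (sym Φ[0]) (sym Φ[-P])) ⟩
    shape (Φ 0ℤ - Φ (- P′)) ∎)
    where
    open ≡-Reasoning
    I P′ e₀ e₁ e₂ r r₀ r₁ : ℤ
    I = + i
    P′ = + P
    e₀ = j₀ ΦJet
    e₁ = j₁ ΦJet
    e₂ = j₂ ΦJet
    r = proj₁ (Φ-expansion (I * P′))
    r₀ = proj₁ (Φ-expansion 0ℤ)
    r₁ = proj₁ (Φ-expansion (- P′))
    R : ℤ
    R = I * I * I * r - I * r₁
    shape : ℤ → ℤ
    shape z = (I + I * I) * (e₂ * (P′ * P′)) + P′ * (P′ * P′) * R + I * z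
    Φ[iP] : Φ (I * P′) ≡ eval ΦJet (I * P′) + I * P′ * (I * P′) * (I * P′) * r
    Φ[iP] = proj₂ (Φ-expansion (I * P′))
    Φ[0] : Φ 0ℤ ≡ eval ΦJet 0ℤ + 0ℤ * 0ℤ * 0ℤ * r₀
    Φ[0] = proj₂ (Φ-expansion 0ℤ)
    Φ[-P] : Φ (- P′) ≡ eval ΦJet (- P′) + - P′ * - P′ * - P′ * r₁
    Φ[-P] = proj₂ (Φ-expansion (- P′))
    identity : ∀ e₀ e₁ e₂ r r₀ r₁ I P →
      (e₀ + e₁ * (I * P) + e₂ * ((I * P) * (I * P)) + (I * P) * (I * P) * (I * P) * r) -
      (e₀ + e₁ * 0ℤ + e₂ * (0ℤ * 0ℤ) + 0ℤ * 0ℤ * 0ℤ * r₀) ≡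
      (I + I * I) * (e₂ * (P * P)) + P * (P * P) * (I * I * I * r - I * r₁) +
      I * ((e₀ + e₁ * 0ℤ + e₂ * (0ℤ * 0ℤ) + 0ℤ * 0ℤ * 0ℤ * r₀) -
           (e₀ + e₁ * - P + e₂ * (- P * - P) + - P * - P * - P * r₁))
    identity = solve-∀

  Φ-congruence : ∀ {q} → Φ 0ℤ ≡ Φ (- + P) → q ∣ + P * (+ P * + P) → q ∣ j₂ ΦJet * (+ P * + P) →
                 ∀ i → Φ (+ (i ℕ.* P)) ≡ Φ 0ℤ [modℤ q ]
  Φ-congruence {q} symmetric q∣P³ q∣e₂P² i = modℤ (subst (q ∣_) (sym (proj₂ (Φ-difference i)))
    (∣m∣n⇒∣m+n (∣m∣n⇒∣m+n (∣n⇒∣m*n (+ i + + i * + i) q∣e₂P²) (∣m⇒∣m*n _ q∣P³)) (∣n⇒∣m*n (+ i) q∣0)))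
    where
    q∣0 : q ∣ Φ 0ℤ - Φ (- + P)
    q∣0 = subst (q ∣_) (sym (trans (cong (λ v → Φ 0ℤ - v) (sym symmetric)) (ℤP.+-inverseʳ (Φ 0ℤ))))
                (∣ᵤ⇒∣ (ℕD._∣0 _))

  Φ-congruence-P : ∀ i → Φ (+ (i ℕ.* P)) ≡ Φ 0ℤ [modℤ + P ]
  Φ-congruence-P i = prod-modℤ P (λ u _ → factor u)
    where
    iP≡0 : + (i ℕ.* P) ≡ 0ℤ [modℤ + P ]
    iP≡0 = modℤ (divides (+ i) (trans (ℤP.+-identityʳ _) (ℤP.pos-* i P)))
    factor : ∀ u → coprimePart (λ u → + u + + (i ℕ.* P)) u ≡ coprimePart (λ u → + u + 0ℤ) u [modℤ + P ]
    factor u with does (p ℕD.∣? u)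
    ... | true  = modℤ-refl
    ... | false = modℤ-+ (modℤ-refl {x = + u}) iP≡0

  module Doubling (p>3 : 3 < p) where

    p∤2 : ¬ p ℕD.∣ 2
    p∤2 p∣2 = ℕP.<⇒≱ (ℕP.<-trans (ℕP.n<1+n 2) p>3) (ℕD.∣⇒≤ p∣2)

    p∤3 : ¬ p ℕD.∣ 3
    p∤3 p∣3 = ℕP.<⇒≱ p>3 (ℕD.∣⇒≤ p∣3)

    2∤p : ¬ 2 ℕD.∣ p
    2∤p 2∣p = Prime.notComposite p-prime (composite (ℕP.<-trans (ℕP.n<1+n 2) p>3) 2∣p)

    2∤P : ¬ 2 ℕD.∣ P
    2∤P = ^-indivisible prime[2] 2∤p (suc s)

    half : ℕ
    half = suc (P / 2)

    2*half≡1+P : 2 ℕ.* half ≡ suc P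
    2*half≡1+P = trans (ℕP.*-suc 2 (P / 2)) (cong suc (sym (odd≡1+2*half 2∤P)))

    double halve : ℕ → ℕ
    double u = (2 ℕ.* u) % P
    halve  u = (half ℕ.* u) % P

    *-%-cancel : ∀ a b → (a ℕ.* (b % P)) % P ≡ (a ℕ.* b) % P
    *-%-cancel a b = begin
      (a ℕ.* (b % P)) % P         ≡⟨ ℕDM.%-distribˡ-* a (b % P) P ⟩
      (a % P ℕ.* (b % P % P)) % P ≡⟨ cong (λ x → (a % P ℕ.* x) % P) (ℕDM.m%n%n≡m%n b P) ⟩
      (a % P ℕ.* (b % P)) % P     ≡⟨ sym (ℕDM.%-distribˡ-* a b P) ⟩
      (a ℕ.* b) % P ∎
      where open ≡-Reasoning

    inverse : ∀ a b → a ℕ.* b ≡ suc P → ∀ u → u < P → (a ℕ.* ((b ℕ.* u) % P)) % P ≡ u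
    inverse a b ab≡1+P u u<P = begin
      (a ℕ.* ((b ℕ.* u) % P)) % P ≡⟨ *-%-cancel a (b ℕ.* u) ⟩
      (a ℕ.* (b ℕ.* u)) % P       ≡⟨ cong (_% P) (sym (ℕP.*-assoc a b u)) ⟩
      (a ℕ.* b ℕ.* u) % P         ≡⟨ cong (λ x → (x ℕ.* u) % P) ab≡1+P ⟩
      (u ℕ.+ P ℕ.* u) % P         ≡⟨ cong (λ x → (u ℕ.+ x) % P) (ℕP.*-comm P u) ⟩
      (u ℕ.+ u ℕ.* P) % P         ≡⟨ ℕDM.[m+kn]%n≡m%n u u P ⟩
      u % P                       ≡⟨ ℕDM.m<n⇒m%n≡m u<P ⟩
      u ∎
      where open ≡-Reasoning

    double-halve : ∀ u → u < P → double (halve u) ≡ u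
    double-halve = inverse 2 half 2*half≡1+P

    halve-double : ∀ u → u < P → halve (double u) ≡ u
    halve-double = inverse half 2 (trans (ℕP.*-comm half 2) 2*half≡1+P)

    p∣double⇔p∣ : ∀ u → (p ℕD.∣ double u → p ℕD.∣ u) × (p ℕD.∣ u → p ℕD.∣ double u)
    p∣double⇔p∣ u = to , λ p∣u → ℕD.%-presˡ-∣ (ℕD.∣n⇒∣m*n 2 p∣u) p∣P
      where
      to : p ℕD.∣ double u → p ℕD.∣ u
      to p∣2u%P with euclidsLemma 2 u p-prime (ℕD.∣n∣m%n⇒∣m p∣P p∣2u%P)
      ... | inj₁ p∣2 = ⊥-elim (p∤2 p∣2)
      ... | inj₂ p∣u = p∣u

    double≡2* : ∀ u → + double u ≡ + 2 * + u [modℤ + P ]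
    double≡2* u = modℤ (divides (- + ((2 ℕ.* u) / P)) (begin
      + double u - + 2 * + u
        ≡⟨ cong (λ x → + double u - x) (sym (ℤP.pos-* 2 u)) ⟩
      + double u - + (2 ℕ.* u)
        ≡⟨ cong (λ x → + double u - + x) (ℕDM.m≡m%n+[m/n]*n (2 ℕ.* u) P) ⟩
      + double u - + (double u ℕ.+ (2 ℕ.* u) / P ℕ.* P)
        ≡⟨ cong (λ x → + double u - x) (ℤP.pos-+ (double u) _) ⟩
      + double u - (+ double u + + ((2 ℕ.* u) / P ℕ.* P))
        ≡⟨ cong (λ x → + double u - (+ double u + x)) (ℤP.pos-* ((2 ℕ.* u) / P) P) ⟩
      + double u - (+ double u + + ((2 ℕ.* u) / P) * + P)
        ≡⟨ cancel (+ double u) (+ ((2 ℕ.* u) / P)) (+ P) ⟩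
      - + ((2 ℕ.* u) / P) * + P ∎))
      where
      open ≡-Reasoning
      cancel : ∀ r k q → r - (r + k * q) ≡ - k * q
      cancel = solve-∀

    doubledJet : ℕ → Jet
    doubledJet u = ifDivisible u oneⱼ (jet (+ 2 * + u) 1ℤ 0ℤ)

    ΦJet≡doubled : ΦJet ≡ Jet∏.prod P doubledJet [modⱼ + P ]
    ΦJet≡doubled = subst (_≡ Jet∏.prod P doubledJet [modⱼ + P ])
      (sym (Jet∏.prod-permute P unitJet double halve (λ u _ → ℕDM.m%n<n _ P) (λ u _ → ℕDM.m%n<n _ P)
                               double-halve halve-double))
      (prod-modⱼ P (λ u _ → factor u))
      where
      factor : ∀ u → unitJet (double u) ≡ doubledJet u [modⱼ + P ]
      factor u with p∣double⇔p∣ u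
      ... | to , from rewrite ifDivisible-⇔ {a = oneⱼ} {b = jet (+ double u) 1ℤ 0ℤ} to from
                    with does (p ℕD.∣? u)
      ... | true  = modⱼ modℤ-refl modℤ-refl modℤ-refl
      ... | false = modⱼ (double≡2* u) modℤ-refl modℤ-refl

    dilate-doubled : dilate (+ 2) (Jet∏.prod P doubledJet) ≡ prod P (λ u → ifDivisible u 1ℤ (+ 2)) ·ⱼ ΦJet
    dilate-doubled = trans (dilate-prod (+ 2) P doubledJet)
                           (trans (Jet∏.prod-cong P (λ u _ → factor u)) (prod-·ⱼ P _ unitJet))
      where
      factor : ∀ u → dilate (+ 2) (doubledJet u) ≡ ifDivisible u 1ℤ (+ 2) ·ⱼ unitJet u
      factor u with does (p ℕD.∣? u)
      ... | true  = refl
      ... | false = refl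

    -- Doubling the units permutes them mod P, and dilating t ↦ 2t turns ∏ (2u + t) into K · ΦJet;
    -- comparing coefficients gives e₀ ≡ K e₀ and 4 e₂ ≡ K e₂, hence 3 e₀ e₂ ≡ 0 (mod P).
    P∣j₂ΦJet : + P ∣ j₂ ΦJet
    P∣j₂ΦJet = subst (+ P ∣_) (ℤP.+-identityʳ e₂)
      (∣-difference (modℤ-cancel p-prime (suc s) (+ 3 * e₀) 3e₀-indivisible 3e₀e₂≡0))
      where
      open SetoidReasoning (modℤ-setoid (+ P))
      K e₀ e₂ : ℤ
      K = prod P (λ u → ifDivisible u 1ℤ (+ 2))
      e₀ = j₀ ΦJet
      e₂ = j₂ ΦJet
      e₀≡Ke₀ : e₀ ≡ K * e₀ [modℤ + P ]
      e₀≡Ke₀ = modℤ-trans (mod₀ ΦJet≡doubled) (modℤ-reflexive (cong j₀ dilate-doubled))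
      4e₂≡Ke₂ : + 2 * + 2 * e₂ ≡ K * e₂ [modℤ + P ]
      4e₂≡Ke₂ = modℤ-trans (modℤ-*ˡ (+ 2 * + 2) (mod₂ ΦJet≡doubled)) (modℤ-reflexive (cong j₂ dilate-doubled))
      swap : ∀ a k b → a * (k * b) ≡ k * a * b
      swap = solve-∀
      4e₀e₂≡e₀e₂ : e₀ * (+ 2 * + 2 * e₂) ≡ e₀ * e₂ [modℤ + P ]
      4e₀e₂≡e₀e₂ = begin
        e₀ * (+ 2 * + 2 * e₂) ≈⟨ modℤ-*ˡ e₀ 4e₂≡Ke₂ ⟩
        e₀ * (K * e₂)         ≡⟨ swap e₀ K e₂ ⟩
        K * e₀ * e₂           ≈⟨ modℤ-*ʳ e₂ (modℤ-sym e₀≡Ke₀) ⟩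
        e₀ * e₂ ∎
      difference : ∀ e₀ e₂ → e₀ * (+ 2 * + 2 * e₂) - e₀ * e₂ ≡ + 3 * e₀ * e₂ - + 3 * e₀ * 0ℤ
      difference = solve-∀
      3e₀e₂≡0 : + 3 * e₀ * e₂ ≡ + 3 * e₀ * 0ℤ [modℤ + P ]
      3e₀e₂≡0 = modℤ (subst (+ P ∣_) (difference e₀ e₂) (∣-difference 4e₀e₂≡e₀e₂))
      3e₀-indivisible : ¬ + p ∣ + 3 * e₀
      3e₀-indivisible = *-indivisible p-prime {+ 3} (p∤3 ∘ ∣⇒∣ᵤ) j₀ΦJet-indivisible

  Φ-congruence-P² : ∀ h → ℕ.pred p ℕ.* Q ≡ h ℕ.+ h →
                    ∀ i → Φ (+ (i ℕ.* P)) ≡ Φ 0ℤ [modℤ + (p ℕ.^ (2 ℕ.* suc s)) ]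
  Φ-congruence-P² h even = subst (λ q → ∀ i → Φ (+ (i ℕ.* P)) ≡ Φ 0ℤ [modℤ q ])
    (sym (trans (+-^-* p (suc s) 2) (^2≡square (+ P))))
    (Φ-congruence (Φ-symmetric h even) (∣n⇒∣m*n (+ P) ∣-refl) (∣n⇒∣m*n (j₂ ΦJet) ∣-refl))

  Φ-congruence-P³ : 3 < p → ∀ i → Φ (+ (i ℕ.* P)) ≡ Φ 0ℤ [modℤ + (p ℕ.^ (3 ℕ.* suc s)) ]
  Φ-congruence-P³ p>3 = subst (λ q → ∀ i → Φ (+ (i ℕ.* P)) ≡ Φ 0ℤ [modℤ q ])
    (sym (trans (+-^-* p (suc s) 3) (^3≡cube (+ P))))
    (Φ-congruence (Φ-symmetric (p / 2 ℕ.* Q) even) ∣-refl P³∣e₂P²)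
    where
    open Doubling p>3
    double-product : ∀ h Q → 2 ℕ.* h ℕ.* Q ≡ h ℕ.* Q ℕ.+ h ℕ.* Q
    double-product = ℕSolver.solve-∀
    even : ℕ.pred p ℕ.* Q ≡ p / 2 ℕ.* Q ℕ.+ p / 2 ℕ.* Q
    even = trans (cong (λ n → ℕ.pred n ℕ.* Q) (odd≡1+2*half 2∤p)) (double-product (p / 2) Q)
    P³∣e₂P² : + P * (+ P * + P) ∣ j₂ ΦJet * (+ P * + P)
    P³∣e₂P² = *-monoˡ-∣ (+ P * + P) P∣j₂ΦJet

  binomial-congruence : ∀ e → (∀ i → Φ (+ (i ℕ.* P)) ≡ Φ 0ℤ [modℤ + (p ℕ.^ e) ]) → ∀ {a b} → b ≤ a →
                        + ((a ℕ.* P) C (b ℕ.* P)) ≡ + ((a ℕ.* Q) C (b ℕ.* Q)) [modℤ + (p ℕ.^ e) ]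
  binomial-congruence e Φ-periodic {a} {b} b≤a =
    subst₂ (λ x y → + (x C (b ℕ.* P)) ≡ + (y C (b ℕ.* Q)) [modℤ + (p ℕ.^ e) ])
           (a∸b+b≡a P) (a∸b+b≡a Q) (binomial-step e Φ-periodic (a ∸ b) b)
    where
    a∸b+b≡a : ∀ R → (a ∸ b) ℕ.* R ℕ.+ b ℕ.* R ≡ a ℕ.* R
    a∸b+b≡a R = trans (sym (ℕP.*-distribʳ-+ R (a ∸ b) b)) (cong (ℕ._* R) (ℕP.m∸n+n≡m b≤a))

^-∣-^ : ∀ m {k e} → k ≤ e → + (m ℕ.^ k) ∣ + (m ℕ.^ e)
^-∣-^ m {k} {e} k≤e = ∣ᵤ⇒∣ (ℕD.divides (m ℕ.^ (e ∸ k)) (begin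
  m ℕ.^ e                       ≡⟨ cong (m ℕ.^_) (sym (ℕP.m+[n∸m]≡n k≤e)) ⟩
  m ℕ.^ (k ℕ.+ (e ∸ k))         ≡⟨ ℕP.^-distribˡ-+-* m k (e ∸ k) ⟩
  m ℕ.^ k ℕ.* m ℕ.^ (e ∸ k)     ≡⟨ ℕP.*-comm (m ℕ.^ k) _ ⟩
  m ℕ.^ (e ∸ k) ℕ.* m ℕ.^ k ∎))
  where open ≡-Reasoning

telescope : ∀ (x : ℕ → ℤ) p (E : ℕ → ℕ) → (∀ n → x (suc n) ≡ x n [modℤ + (p ℕ.^ E (suc n)) ]) →
            ∀ {K j k} → j ≤ k → (∀ n → j < n → K ≤ E n) → x k ≡ x j [modℤ + (p ℕ.^ K) ]
telescope x p E step {K} {j} j≤k K≤E = go (ℕP.≤⇒≤′ j≤k)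
  where
  go : ∀ {k} → j ℕ.≤′ k → x k ≡ x j [modℤ + (p ℕ.^ K) ]
  go ℕ.≤′-refl            = modℤ-refl
  go (ℕ.≤′-step {k} j≤′k) =
    modℤ-trans (modℤ-weaken (^-∣-^ p (K≤E (suc k) (s≤s (ℕP.≤′⇒≤ j≤′k)))) (step k)) (go j≤′k)

m/n<o⇒m<o*n : ∀ m n o .{{_ : NonZero n}} → m / n < o → m < o ℕ.* n
m/n<o⇒m<o*n m n o m/n<o = begin-strict
  m                     ≡⟨ ℕDM.m≡m%n+[m/n]*n m n ⟩
  m % n ℕ.+ m / n ℕ.* n <⟨ ℕP.+-monoˡ-< (m / n ℕ.* n) (ℕDM.m%n<n m n) ⟩
  suc (m / n) ℕ.* n     ≤⟨ ℕP.*-monoˡ-≤ n m/n<o ⟩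
  o ℕ.* n ∎
  where open ℕP.≤-Reasoning

[k∸1]/d≤k : ∀ k d .{{_ : NonZero d}} → (k ∸ 1) / d ≤ k
[k∸1]/d≤k k d = ℕP.≤-trans (ℕDM.m/n≤m (k ∸ 1) d) (ℕP.m∸n≤m k 1)

[k∸1]/d<n⇒k≤d*n : ∀ {k} d .{{_ : NonZero d}} → 1 ≤ k → ∀ n → (k ∸ 1) / d < n → k ≤ d ℕ.* n
[k∸1]/d<n⇒k≤d*n {suc k} d _ n k/d<n = subst (suc k ≤_) (ℕP.*-comm n d) (m/n<o⇒m<o*n k d n k/d<n)

-- Modulo 2 there is a single unit, so the step from level 0 to 1 only holds modulo P = 2.
exponent₂ : ℕ → ℕ
exponent₂ 1 = 1
exponent₂ s = 2 ℕ.* s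

k/2<s⇒k≤exponent₂ : ∀ {k} s → k / 2 < s → k ≤ exponent₂ s
k/2<s⇒k≤exponent₂ {k} 1             k/2<1 = ℕP.≤-pred (m/n<o⇒m<o*n k 2 1 k/2<1)
k/2<s⇒k≤exponent₂ {k} (suc (suc t)) k/2<s =
  subst (k ≤_) (ℕP.*-comm (suc (suc t)) 2) (ℕP.<⇒≤ (m/n<o⇒m<o*n k 2 (suc (suc t)) k/2<s))

prime[3] : Prime 3
prime[3] = toWitness {a? = prime? 3} tt

binomialAt : ℕ → ℕ → ℕ → ℕ → ℤ
binomialAt p n m k = + ((n ℕ.* p ℕ.^ k) C (m ℕ.* p ℕ.^ k))

module _ {n m : ℕ} (m≤n : m ≤ n) where

  binomial-step-large : ∀ {p} → Prime p → 3 < p → ∀ s →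
    binomialAt p n m (suc s) ≡ binomialAt p n m s [modℤ + (p ℕ.^ (3 ℕ.* suc s)) ]
  binomial-step-large p-prime p>3 s = binomial-congruence (3 ℕ.* suc s) (Φ-congruence-P³ p>3) m≤n
    where open PrimePower p-prime s

  binomial-step-three : ∀ s → binomialAt 3 n m (suc s) ≡ binomialAt 3 n m s [modℤ + (3 ℕ.^ (2 ℕ.* suc s)) ]
  binomial-step-three s = binomial-congruence (2 ℕ.* suc s) (Φ-congruence-P² Q (cong (Q ℕ.+_) (ℕP.+-identityʳ Q))) m≤n
    where open PrimePower prime[3] s

  binomial-step-two : ∀ s → binomialAt 2 n m (suc s) ≡ binomialAt 2 n m s [modℤ + (2 ℕ.^ exponent₂ (suc s)) ]
  binomial-step-two zero    = binomial-congruence 1 Φ-congruence-P m≤n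
    where open PrimePower prime[2] 0
  binomial-step-two (suc t) = binomial-congruence (2 ℕ.* suc (suc t)) (Φ-congruence-P² (2 ℕ.^ t) (even (2 ℕ.^ t))) m≤n
    where
    open PrimePower prime[2] (suc t)
    even : ∀ x → 1 ℕ.* (2 ℕ.* x) ≡ x ℕ.+ x
    even = ℕSolver.solve-∀

  binomial-telescope : ∀ p E → (∀ s → binomialAt p n m (suc s) ≡ binomialAt p n m s [modℤ + (p ℕ.^ E (suc s)) ]) →
    ∀ {j k} → j ≤ k → (∀ s → j < s → k ≤ E s) →
    ((n ℕ.* p ℕ.^ k) C (m ℕ.* p ℕ.^ k)) ≡ ((n ℕ.* p ℕ.^ j) C (m ℕ.* p ℕ.^ j)) [mod p ℕ.^ k ]
  binomial-telescope p E step j≤k k≤E = ∣⇒∣ᵤ (∣-difference (telescope (binomialAt p n m) p E step j≤k k≤E))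

mainTheorem2 : (n m k : ℕ) → m ≤ n → 1 ≤ k →
    ((p : ℕ) → Prime p → p > 3 →
    ((n ℕ.* p ℕ.^ k) C (m ℕ.* p ℕ.^ k)) ≡ ((n ℕ.* p ℕ.^ ((k ∸ 1) / 3)) C (m ℕ.* p ℕ.^ ((k ∸ 1) / 3))) [mod p ℕ.^ k ])
    × (((n ℕ.* 2 ℕ.^ k) C (m ℕ.* 2 ℕ.^ k)) ≡ ((n ℕ.* 2 ℕ.^ (k / 2)) C (m ℕ.* 2 ℕ.^ (k / 2))) [mod 2 ℕ.^ k ])
    × (((n ℕ.* 3 ℕ.^ k) C (m ℕ.* 3 ℕ.^ k)) ≡ ((n ℕ.* 3 ℕ.^ ((k ∸ 1) / 2)) C (m ℕ.* 3 ℕ.^ ((k ∸ 1) / 2))) [mod 3 ℕ.^ k ])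
mainTheorem2 n m k m≤n 1≤k =
    (λ p p-prime p>3 → binomial-telescope m≤n p (3 ℕ.*_) (binomial-step-large m≤n p-prime p>3)
                         ([k∸1]/d≤k k 3) ([k∸1]/d<n⇒k≤d*n 3 1≤k))
  , binomial-telescope m≤n 2 exponent₂ (binomial-step-two m≤n) (ℕDM.m/n≤m k 2) k/2<s⇒k≤exponent₂
  , binomial-telescope m≤n 3 (2 ℕ.*_) (binomial-step-three m≤n) ([k∸1]/d≤k k 2) ([k∸1]/d<n⇒k≤d*n 2 1≤k)
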